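{- Let $G=K_{n_1,\ldots,n_k}$ and suppose $G$ has an equitable $q$-coloring. Let $p=p(q:n_1,\ldots,n_k)$. Then $G$ has no equitable $(p-1)$-coloring.
   Context: All graphs are finite and simple. For a graph $G$ with $N=|V(G)|$ vertices, an equitable $q$-coloring of $G$ is a partition of $V(G)$ into $q$ (possibly empty) independent sets, each of size $\lfloor N/q\rfloor$ or $\lceil N/q\rceil$. $K_{n_1,\ldots,n_k}$ is the complete $k$-partite graph with partite sets $X_1,\ldots,X_k$, $|X_i|=n_i$. Definition of $p$: suppose $K_{n_1,\ldots,n_k}$ has an equitable $q$-coloring. Then $p(q:n_1,\ldots,n_k)=\lceil n_1/d\rceil+\cdots+\lceil n_k/d\rceil$, where $d$ is the minimum integer with $d\ge\lceil (n_1+\cdots+n_k)/q\rceil$ satisfying at least one of: (i) there exist $i\ne j$ such that neither $n_i$ nor $n_j$ is divisible by $d$; (ii) there exists $i$ with $n_i/\lfloor n_i/d\rfloor>d+1$. -}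

module Defs where

open import Data.Nat using (ℕ; zero; suc; _+_; _*_; _∸_; _≤_; _<_)
open import Data.Nat.DivMod using (_/_)
open import Data.Nat.Divisibility using (_∣_)
open import Data.Fin using (Fin; zero; suc)
open import Data.Fin.Properties using (_≟_)
open import Data.Product using (Σ; _,_; ∃₂; _×_)
open import Data.Sum using (_⊎_)
open import Relation.Nullary using (¬_; yes; no)
open import Relation.Binary.PropositionalEquality using (_≡_; _≢_)

sumFin : (m : ℕ) → (Fin m → ℕ) → ℕ
sumFin zero    f = 0
sumFin (suc m) f = f zero + sumFin m (λ i → f (suc i))

countEq : {q : ℕ} (m : ℕ) → (Fin m → Fin q) → Fin q → ℕ
countEq zero    f j = 0
countEq (suc m) f j with f zero ≟ j
... | yes _ = suc (countEq m (λ x → f (suc x)) j)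
... | no  _ = countEq m (λ x → f (suc x)) j

-- Floor and ceiling of m / q (value at q = 0 is irrelevant: it is only
-- used where there is a colour class, i.e. an element of Fin q).
⌊_/_⌋ : ℕ → ℕ → ℕ
⌊ m / zero  ⌋ = 0
⌊ m / suc q ⌋ = m / suc q

⌈_/_⌉ : ℕ → ℕ → ℕ
⌈ m / zero  ⌉ = 0
⌈ m / suc q ⌉ = (m + q) / suc q

-- The complete k-partite graph K_{n_1,...,n_k}, n : Fin k → ℕ.
-- Vertices: pairs (i , x) with x ∈ X_i = Fin (n i).
-- Two vertices are adjacent iff they lie in different partite sets.

Vertex : {k : ℕ} → (Fin k → ℕ) → Set
Vertex {k} n = Σ (Fin k) (λ i → Fin (n i))

Adj : {k : ℕ} (n : Fin k → ℕ) → Vertex n → Vertex n → Set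
Adj n (i , x) (j , y) = i ≢ j

order : {k : ℕ} → (Fin k → ℕ) → ℕ
order {k} n = sumFin k n

classSize : {k q : ℕ} (n : Fin k → ℕ) → (Vertex n → Fin q) → Fin q → ℕ
classSize {k} n c j = sumFin k (λ i → countEq (n i) (λ x → c (i , x)) j)

record EquitableColoring {k : ℕ} (n : Fin k → ℕ) (q : ℕ) : Set where
  field
    colour      : Vertex n → Fin q
    independent : ∀ u v → Adj n u v → colour u ≢ colour v
    equitable   : ∀ j → classSize n colour j ≡ ⌊ order n / q ⌋
                        ⊎ classSize n colour j ≡ ⌈ order n / q ⌉

HasEquitableColoring : {k : ℕ} (n : Fin k → ℕ) (q : ℕ) → Set
HasEquitableColoring n q = EquitableColoring n q

CondI : {k : ℕ} (n : Fin k → ℕ) → ℕ → Set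
CondI n d = ∃₂ λ i j → i ≢ j × ¬ (d ∣ n i) × ¬ (d ∣ n j)

-- (ii) there exists i with n_i / ⌊n_i/d⌋ > d + 1, written without
-- division as (d + 1) * ⌊n_i/d⌋ < n_i.
CondII : {k : ℕ} (n : Fin k → ℕ) → ℕ → Set
CondII n d = Σ _ λ i → (d + 1) * ⌊ n i / d ⌋ < n i

IsMinD : {k : ℕ} (n : Fin k → ℕ) (q d : ℕ) → Set
IsMinD n q d =
  (⌈ order n / q ⌉ ≤ d × (CondI n d ⊎ CondII n d))
  × (∀ d′ → ⌈ order n / q ⌉ ≤ d′ → (CondI n d′ ⊎ CondII n d′) → d ≤ d′)

pVal : {k : ℕ} (n : Fin k → ℕ) (d : ℕ) → ℕ
pVal {k} n d = sumFin k (λ i → ⌈ n i / d ⌉)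

-- Every independent set of K_{n_1,...,n_k} lies inside one part, so an equitable
-- r-colouring with class sizes s = ⌊N/r⌋ ≤ t = ⌈N/r⌉ ≤ s + 1 splits X_i into
-- m_i classes, with m_i s ≤ n_i ≤ m_i t and Σ m_i = r (at most r if s = 0).
-- If t ≤ d then ⌈n_i/d⌉ ≤ m_i, so p ≤ r. Otherwise d ≤ s, so m_i ≤ ⌈n_i/d⌉, and
-- the inequality is strict for two parts: for all parts when d < s, and when
-- d = s for the two parts given by condition (i), while condition (ii) cannot
-- hold since n_i ≤ m_i (d+1) with m_i ≤ ⌊n_i/d⌋. Then p ≥ r + 2. Either way
-- r ≠ p − 1. Only the fact that d satisfies (i) or (ii) is used, not minimality.
module Submission where

open import Defs
open import Data.Nat using (ℕ; zero; suc; _+_; _*_; _∸_; _≤_; _<_; _≤?_; z≤n; s≤s; s≤s⁻¹; z<s; NonZero)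
open import Data.Nat.Properties hiding (suc-injective) renaming (_≟_ to _≟ℕ_)
open import Algebra.Properties.CommutativeSemigroup +-commutativeSemigroup using (interchange)
open import Data.Nat.DivMod using (_/_; m*n/n≡m; /-monoˡ-≤; m<n*o⇒m/o<n; m/n≡1+[m∸n]/n)
open import Data.Nat.Divisibility using (_∣_; divides)
open import Data.Fin using (Fin; zero; suc; fromℕ<)
open import Data.Fin.Properties using (_≟_; suc-injective)
open import Data.Product using (∃; ∃₂; _×_; _,_; proj₁; proj₂)
open import Data.Sum using (_⊎_; inj₁; inj₂)
open import Data.Empty using (⊥-elim)
open import Function using (_∘_)
open import Relation.Nullary using (¬_; yes; no)
open import Relation.Binary.PropositionalEquality

sumFin-cong : ∀ k {f g : Fin k → ℕ} → (∀ i → f i ≡ g i) → sumFin k f ≡ sumFin k g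
sumFin-cong zero    f≡g = refl
sumFin-cong (suc k) f≡g = cong₂ _+_ (f≡g zero) (sumFin-cong k (f≡g ∘ suc))

sumFin-zero : ∀ k {f : Fin k → ℕ} → (∀ i → f i ≡ 0) → sumFin k f ≡ 0
sumFin-zero zero    f≡0 = refl
sumFin-zero (suc k) f≡0 = cong₂ _+_ (f≡0 zero) (sumFin-zero k (f≡0 ∘ suc))

sumFin-one : ∀ k → sumFin k (λ _ → 1) ≡ k
sumFin-one zero    = refl
sumFin-one (suc k) = cong suc (sumFin-one k)

sumFin-+ : ∀ k (f g : Fin k → ℕ) → sumFin k (λ i → f i + g i) ≡ sumFin k f + sumFin k g
sumFin-+ zero    f g = refl
sumFin-+ (suc k) f g = trans (cong (f zero + g zero +_) (sumFin-+ k (f ∘ suc) (g ∘ suc)))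
                             (interchange (f zero) (g zero) _ _)

sumFin-*ʳ : ∀ k (f : Fin k → ℕ) c → sumFin k (λ i → f i * c) ≡ sumFin k f * c
sumFin-*ʳ zero    f c = refl
sumFin-*ʳ (suc k) f c = trans (cong (f zero * c +_) (sumFin-*ʳ k (f ∘ suc) c))
                              (sym (*-distribʳ-+ c (f zero) _))

sumFin-comm : ∀ k r (e : Fin k → Fin r → ℕ) →
              sumFin k (λ i → sumFin r (e i)) ≡ sumFin r (λ j → sumFin k (λ i → e i j))
sumFin-comm zero    r e = sym (sumFin-zero r (λ _ → refl))
sumFin-comm (suc k) r e = trans (cong (sumFin r (e zero) +_) (sumFin-comm k r (e ∘ suc)))
                                (sym (sumFin-+ r (e zero) _))

≤-sumFin : ∀ k (f : Fin k → ℕ) i → f i ≤ sumFin k f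
≤-sumFin (suc k) f zero    = m≤m+n _ _
≤-sumFin (suc k) f (suc i) = ≤-trans (≤-sumFin k (f ∘ suc) i) (m≤n+m _ _)

sumFin-mono-≤ : ∀ k {f g : Fin k → ℕ} → (∀ i → f i ≤ g i) → sumFin k f ≤ sumFin k g
sumFin-mono-≤ zero    f≤g = z≤n
sumFin-mono-≤ (suc k) f≤g = +-mono-≤ (f≤g zero) (sumFin-mono-≤ k (f≤g ∘ suc))

sumFin-mono-< : ∀ k {f g : Fin k → ℕ} → (∀ i → f i ≤ g i) → ∀ a → f a < g a →
                1 + sumFin k f ≤ sumFin k g
sumFin-mono-< (suc k) f≤g zero fa<ga = +-mono-≤ fa<ga (sumFin-mono-≤ k (f≤g ∘ suc))
sumFin-mono-< (suc k) {f} {g} f≤g (suc a) fa<ga =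
  subst (_≤ sumFin (suc k) g) (+-suc (f zero) _)
        (+-mono-≤ (f≤g zero) (sumFin-mono-< k (f≤g ∘ suc) a fa<ga))

sumFin-mono-<₂ : ∀ k {f g : Fin k → ℕ} → (∀ i → f i ≤ g i) → ∀ a b → a ≢ b →
                 f a < g a → f b < g b → 2 + sumFin k f ≤ sumFin k g
sumFin-mono-<₂ (suc k) f≤g zero zero a≢b _ _ = ⊥-elim (a≢b refl)
sumFin-mono-<₂ (suc k) {f} {g} f≤g zero (suc b) _ fa<ga fb<gb =
  subst (_≤ sumFin (suc k) g) (cong suc (+-suc (f zero) _))
        (+-mono-≤ fa<ga (sumFin-mono-< k (f≤g ∘ suc) b fb<gb))
sumFin-mono-<₂ (suc k) f≤g (suc a) zero a≢b fa<ga fb<gb =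
  sumFin-mono-<₂ (suc k) f≤g zero (suc a) (a≢b ∘ sym) fb<gb fa<ga
sumFin-mono-<₂ (suc k) {f} {g} f≤g (suc a) (suc b) a≢b fa<ga fb<gb =
  subst (_≤ sumFin (suc k) g) (trans (+-suc (f zero) _) (cong suc (+-suc (f zero) _)))
        (+-mono-≤ (f≤g zero) (sumFin-mono-<₂ k (f≤g ∘ suc) a b (a≢b ∘ cong suc) fa<ga fb<gb))

δ : ∀ {r} → Fin r → Fin r → ℕ
δ zero    zero    = 1
δ zero    (suc _) = 0
δ (suc _) zero    = 0
δ (suc a) (suc b) = δ a b

δ-refl : ∀ {r} (a : Fin r) → δ a a ≡ 1
δ-refl zero    = refl
δ-refl (suc a) = δ-refl a

δ-≢ : ∀ {r} {a b : Fin r} → a ≢ b → δ a b ≡ 0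
δ-≢ {a = zero}  {zero}  a≢b = ⊥-elim (a≢b refl)
δ-≢ {a = zero}  {suc b} a≢b = refl
δ-≢ {a = suc a} {zero}  a≢b = refl
δ-≢ {a = suc a} {suc b} a≢b = δ-≢ (a≢b ∘ cong suc)

sumFin-δ : ∀ r (a : Fin r) → sumFin r (δ a) ≡ 1
sumFin-δ (suc r) zero    = cong suc (sumFin-zero r (λ _ → refl))
sumFin-δ (suc r) (suc a) = sumFin-δ r a

countEq-suc : ∀ {q} m (f : Fin (suc m) → Fin q) j →
              countEq (suc m) f j ≡ δ (f zero) j + countEq m (f ∘ suc) j
countEq-suc m f j with f zero ≟ j
... | yes refl = cong (_+ countEq m (f ∘ suc) j) (sym (δ-refl j))
... | no f0≢j  = cong (_+ countEq m (f ∘ suc) j) (sym (δ-≢ f0≢j))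

sumFin-countEq : ∀ r m (f : Fin m → Fin r) → sumFin r (countEq m f) ≡ m
sumFin-countEq r zero    f = sumFin-zero r (λ _ → refl)
sumFin-countEq r (suc m) f = begin
  sumFin r (countEq (suc m) f)
    ≡⟨ sumFin-cong r (countEq-suc m f) ⟩
  sumFin r (λ j → δ (f zero) j + countEq m (f ∘ suc) j)
    ≡⟨ sumFin-+ r _ _ ⟩
  sumFin r (δ (f zero)) + sumFin r (countEq m (f ∘ suc))
    ≡⟨ cong₂ _+_ (sumFin-δ r (f zero)) (sumFin-countEq r m _) ⟩
  suc m
    ∎
  where open ≡-Reasoning

countEq-witness : ∀ {q} m (f : Fin m → Fin q) j → countEq m f j ≢ 0 → ∃ λ x → f x ≡ j
countEq-witness zero    f j c≢0 = ⊥-elim (c≢0 refl)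
countEq-witness (suc m) f j c≢0 with f zero ≟ j
... | yes f0≡j = zero , f0≡j
... | no _     = let x , fx≡j = countEq-witness m (f ∘ suc) j c≢0 in suc x , fx≡j

signum : ℕ → ℕ
signum zero    = 0
signum (suc _) = 1

≤-signum* : ∀ a {u} → a ≤ u → a ≤ signum a * u
≤-signum* zero    _   = z≤n
≤-signum* (suc a) a≤u = subst (suc a ≤_) (sym (+-identityʳ _)) a≤u

signum*-≤ : ∀ a {l} → (0 < a → l ≤ a) → signum a * l ≤ a
signum*-≤ zero    _   = z≤n
signum*-≤ (suc a) l≤a = subst (_≤ suc a) (sym (+-identityʳ _)) (l≤a z<s)

AtMostOnePositive : ∀ k → (Fin k → ℕ) → Set
AtMostOnePositive k g = ∀ i i′ → i ≢ i′ → g i ≡ 0 ⊎ g i′ ≡ 0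

atMostOnePositive-tail : ∀ k {g : Fin (suc k) → ℕ} → AtMostOnePositive (suc k) g →
                         AtMostOnePositive k (g ∘ suc)
atMostOnePositive-tail k one i i′ i≢i′ = one (suc i) (suc i′) (i≢i′ ∘ suc-injective)

atMostOnePositive-others : ∀ k {g : Fin (suc k) → ℕ} → AtMostOnePositive (suc k) g →
                           0 < g zero → ∀ i → g (suc i) ≡ 0
atMostOnePositive-others k one g0>0 i with one zero (suc i) (λ ())
... | inj₁ g0≡0  = ⊥-elim (<-irrefl (sym g0≡0) g0>0)
... | inj₂ gi≡0 = gi≡0

sumFin-atMostOnePositive : ∀ k {g : Fin k → ℕ} → AtMostOnePositive k g →
                           ∀ i → 0 < g i → sumFin k g ≡ g i
sumFin-atMostOnePositive (suc k) {g} one zero g0>0 =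
  trans (cong (g zero +_) (sumFin-zero k (atMostOnePositive-others k one g0>0))) (+-identityʳ _)
sumFin-atMostOnePositive (suc k) {g} one (suc i) gi>0 with one zero (suc i) (λ ())
... | inj₁ g0≡0 = trans (cong (_+ sumFin k (g ∘ suc)) g0≡0)
                        (sumFin-atMostOnePositive k (atMostOnePositive-tail k one) i gi>0)
... | inj₂ gi≡0 = ⊥-elim (<-irrefl (sym gi≡0) gi>0)

sumFin-signum-atMostOnePositive : ∀ k {g : Fin k → ℕ} → AtMostOnePositive k g →
                                  sumFin k (signum ∘ g) ≤ 1
sumFin-signum-atMostOnePositive zero    one = z≤n
sumFin-signum-atMostOnePositive (suc k) {g} one with g zero in g0≡
... | zero  = sumFin-signum-atMostOnePositive k (atMostOnePositive-tail k one)
... | suc _ = ≤-reflexive (cong suc (sumFin-zero k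
                (cong signum ∘ atMostOnePositive-others k one (subst (0 <_) (sym g0≡) z<s))))

signum-sumFin≤ : ∀ k (g : Fin k → ℕ) → signum (sumFin k g) ≤ sumFin k (signum ∘ g)
signum-sumFin≤ zero    g = z≤n
signum-sumFin≤ (suc k) g with g zero
... | zero  = signum-sumFin≤ k (g ∘ suc)
... | suc _ = s≤s z≤n

*≤⇒≤/ : ∀ {m n d} .{{_ : NonZero d}} → m * d ≤ n → m ≤ n / d
*≤⇒≤/ {m} {n} {d} md≤n = subst (_≤ n / d) (m*n/n≡m m d) (/-monoˡ-≤ d md≤n)

⌈/⌉-least : ∀ d {n m} → n ≤ m * suc d → ⌈ n / suc d ⌉ ≤ m
⌈/⌉-least d {n} {m} n≤md = s≤s⁻¹ (m<n*o⇒m/o<n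
  (subst (n + d <_) (+-comm (m * suc d) (suc d)) (+-mono-≤-< n≤md ≤-refl)))

*≤⇒≤⌈/⌉ : ∀ d {n m} → m * suc d ≤ n → m ≤ ⌈ n / suc d ⌉
*≤⇒≤⌈/⌉ d {n} md≤n = *≤⇒≤/ (≤-trans md≤n (m≤m+n n d))

*<⇒<⌈/⌉ : ∀ d {n m} → m * suc d < n → m < ⌈ n / suc d ⌉
*<⇒<⌈/⌉ d {n} {m} md<n =
  *≤⇒≤/ (subst (_≤ n + d) (cong suc (+-comm (m * suc d) d)) (+-monoˡ-≤ d md<n))

⌊/⌋≤⌈/⌉ : ∀ d n → ⌊ n / suc d ⌋ ≤ ⌈ n / suc d ⌉
⌊/⌋≤⌈/⌉ d n = /-monoˡ-≤ (suc d) (m≤m+n n d)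

⌈/⌉≤1+⌊/⌋ : ∀ d n → ⌈ n / suc d ⌉ ≤ suc ⌊ n / suc d ⌋
⌈/⌉≤1+⌊/⌋ d n = begin
  (n + d) / suc d             ≤⟨ /-monoˡ-≤ (suc d) (+-monoʳ-≤ n (n≤1+n d)) ⟩
  (n + suc d) / suc d         ≡⟨ m/n≡1+[m∸n]/n (m≤n+m (suc d) n) ⟩
  suc ((n + suc d ∸ suc d) / suc d) ≡⟨ cong (λ x → suc (x / suc d)) (m+n∸n≡m n (suc d)) ⟩
  suc (n / suc d)             ∎
  where open ≤-Reasoning

*<-of-*suc≤ : ∀ m d {n} → m * suc d ≤ n → 0 < n → m * d < n
*<-of-*suc≤ zero    d m1+d≤n n>0 = n>0
*<-of-*suc≤ (suc m) d {n} m1+d≤n n>0 =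
  <-≤-trans (m<n+m (suc m * d) {suc m} z<s) (subst (_≤ n) (*-suc (suc m) d) m1+d≤n)

distinctPair : ∀ {k} → 2 ≤ k → ∃₂ λ (a b : Fin k) → a ≢ b
distinctPair (s≤s (s≤s _)) = zero , suc zero , λ ()

-- classes i is the number of colour classes inside X_i; they have sizes in [s, t].
record ClassCounts {k : ℕ} (n : Fin k → ℕ) (r s t : ℕ) : Set where
  field
    classes : Fin k → ℕ
    covers  : ∀ i → n i ≤ classes i * t
    fits    : ∀ i → classes i * s ≤ n i
    total≤  : sumFin k classes ≤ r
    total≥  : 1 ≤ s → r ≤ sumFin k classes

deficientPair-tight : ∀ {k} {n : Fin k → ℕ} {d} (m : Fin k → ℕ) →
                      (∀ i → n i ≤ m i * suc (suc d)) → (∀ i → m i * suc d ≤ n i) →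
                      CondI n (suc d) ⊎ CondII n (suc d) →
                      ∃₂ λ a b → a ≢ b × m a * suc d < n a × m b * suc d < n b
deficientPair-tight {n = n} {d} m covers fits (inj₁ (a , b , a≢b , d∤a , d∤b)) =
  a , b , a≢b , short a d∤a , short b d∤b
  where
  short : ∀ i → ¬ (suc d ∣ n i) → m i * suc d < n i
  short i d∤ = ≤∧≢⇒< (fits i) (λ eq → d∤ (divides (m i) (sym eq)))
deficientPair-tight {n = n} {d} m covers fits (inj₂ (i , [d+1]⌊n/d⌋<n)) =
  ⊥-elim (<⇒≱ [d+1]⌊n/d⌋<n n≤[d+1]⌊n/d⌋)
  where
  n≤[d+1]⌊n/d⌋ : n i ≤ (suc d + 1) * (n i / suc d)
  n≤[d+1]⌊n/d⌋ = begin
    n i                         ≤⟨ covers i ⟩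
    m i * suc (suc d)           ≤⟨ *-monoˡ-≤ (suc (suc d)) (*≤⇒≤/ {m i} (fits i)) ⟩
    (n i / suc d) * suc (suc d) ≡⟨ *-comm (n i / suc d) (suc (suc d)) ⟩
    suc (suc d) * (n i / suc d) ≡⟨ cong (_* (n i / suc d)) (+-comm 1 (suc d)) ⟩
    (suc d + 1) * (n i / suc d) ∎
    where open ≤-Reasoning

module _ {k : ℕ} {n : Fin k → ℕ} (2≤k : 2 ≤ k) (n>0 : ∀ i → 1 ≤ n i) {d : ℕ}
         (cond : CondI n (suc d) ⊎ CondII n (suc d)) where

  deficientPair : ∀ {s} (m : Fin k → ℕ) → (∀ i → n i ≤ m i * suc s) →
                  (∀ i → m i * s ≤ n i) → suc d ≤ s →
                  ∃₂ λ a b → a ≢ b × m a * suc d < n a × m b * suc d < n b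
  deficientPair m covers fits 1+d≤s with m≤n⇒m<n∨m≡n 1+d≤s
  ... | inj₂ refl  = deficientPair-tight m covers fits cond
  ... | inj₁ 1+d<s = let a , b , a≢b = distinctPair 2≤k in a , b , a≢b , short a , short b
    where
    short : ∀ i → m i * suc d < n i
    short i = *<-of-*suc≤ (m i) (suc d) (≤-trans (*-monoʳ-≤ (m i) 1+d<s) (fits i)) (n>0 i)

  pVal≤total : ∀ {r s t} → ClassCounts n r s t → t ≤ suc d → pVal n (suc d) ≤ r
  pVal≤total {r} cc t≤1+d = begin
    pVal n (suc d)   ≤⟨ sumFin-mono-≤ k (λ i → ⌈/⌉-least d (covers′ i)) ⟩
    sumFin k classes ≤⟨ total≤ ⟩
    r                ∎
    where
    open ClassCounts cc
    open ≤-Reasoning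
    covers′ : ∀ i → n i ≤ classes i * suc d
    covers′ i = ≤-trans (covers i) (*-monoʳ-≤ (classes i) t≤1+d)

  2+total≤pVal : ∀ {r s t} → ClassCounts n r s t → t ≤ suc s → suc d < t →
                 2 + r ≤ pVal n (suc d)
  2+total≤pVal {r} {s} {t} cc t≤1+s 1+d<t =
    let a , b , a≢b , a< , b< = deficientPair classes covers′ fits 1+d≤s in begin
    2 + r
      ≤⟨ s≤s (s≤s (total≥ (≤-trans (s≤s z≤n) 1+d≤s))) ⟩
    2 + sumFin k classes
      ≤⟨ sumFin-mono-<₂ k classes≤⌈n/d⌉ a b a≢b (*<⇒<⌈/⌉ d a<) (*<⇒<⌈/⌉ d b<) ⟩
    pVal n (suc d)
      ∎
    where
    open ClassCounts cc
    open ≤-Reasoning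
    1+d≤s : suc d ≤ s
    1+d≤s = s≤s⁻¹ (≤-trans 1+d<t t≤1+s)
    covers′ : ∀ i → n i ≤ classes i * suc s
    covers′ i = ≤-trans (covers i) (*-monoʳ-≤ (classes i) t≤1+s)
    classes≤⌈n/d⌉ : ∀ i → classes i ≤ ⌈ n i / suc d ⌉
    classes≤⌈n/d⌉ i = *≤⇒≤⌈/⌉ d (≤-trans (*-monoʳ-≤ (classes i) 1+d≤s) (fits i))

  ClassCounts⇒pVal≢1+ : ∀ {r s t} → ClassCounts n r s t → t ≤ suc s → suc r ≢ pVal n (suc d)
  ClassCounts⇒pVal≢1+ {t = t} cc t≤1+s 1+r≡p with t ≤? suc d
  ... | yes t≤1+d = 1+n≰n (subst (_≤ _) (sym 1+r≡p) (pVal≤total cc t≤1+d))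
  ... | no t≰1+d  = 1+n≰n (subst (2 + _ ≤_) (sym 1+r≡p) (2+total≤pVal cc t≤1+s (≰⇒> t≰1+d)))

module _ {k r : ℕ} {n : Fin k → ℕ} (c : Vertex n → Fin r) where

  partCount : Fin k → Fin r → ℕ
  partCount i = countEq (n i) (λ x → c (i , x))

  sumFin-partCount : ∀ i → sumFin r (partCount i) ≡ n i
  sumFin-partCount i = sumFin-countEq r (n i) (λ x → c (i , x))

  partCount-atMostOnePositive : (∀ u v → Adj n u v → c u ≢ c v) →
                                ∀ j → AtMostOnePositive k (λ i → partCount i j)
  partCount-atMostOnePositive proper j i i′ i≢i′ with partCount i j ≟ℕ 0 | partCount i′ j ≟ℕ 0
  ... | yes ≡0 | _      = inj₁ ≡0
  ... | no _   | yes ≡0 = inj₂ ≡0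
  ... | no ≢0  | no ≢0′ =
    let x , cx≡j = countEq-witness (n i) (λ x → c (i , x)) j ≢0
        y , cy≡j = countEq-witness (n i′) (λ y → c (i′ , y)) j ≢0′
    in ⊥-elim (proper (i , x) (i′ , y) i≢i′ (trans cx≡j (sym cy≡j)))

  module _ (proper : ∀ u v → Adj n u v → c u ≢ c v) {s t : ℕ}
           (bounds : ∀ j → s ≤ classSize n c j × classSize n c j ≤ t) where

    colours : Fin k → ℕ
    colours i = sumFin r (λ j → signum (partCount i j))

    colours-covers : ∀ i → n i ≤ colours i * t
    colours-covers i = begin
      n i
        ≡⟨ sym (sumFin-partCount i) ⟩
      sumFin r (partCount i)
        ≤⟨ sumFin-mono-≤ r (λ j → ≤-signum* (partCount i j) (partCount≤t j)) ⟩
      sumFin r (λ j → signum (partCount i j) * t)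
        ≡⟨ sumFin-*ʳ r _ t ⟩
      colours i * t
        ∎
      where
      open ≤-Reasoning
      partCount≤t : ∀ j → partCount i j ≤ t
      partCount≤t j = ≤-trans (≤-sumFin k (λ i → partCount i j) i) (proj₂ (bounds j))

    colours-fits : ∀ i → colours i * s ≤ n i
    colours-fits i = begin
      colours i * s
        ≡⟨ sym (sumFin-*ʳ r _ s) ⟩
      sumFin r (λ j → signum (partCount i j) * s)
        ≤⟨ sumFin-mono-≤ r (λ j → signum*-≤ (partCount i j) (s≤partCount j)) ⟩
      sumFin r (partCount i)
        ≡⟨ sumFin-partCount i ⟩
      n i
        ∎
      where
      open ≤-Reasoning
      s≤partCount : ∀ j → 0 < partCount i j → s ≤ partCount i j
      s≤partCount j pos = ≤-trans (proj₁ (bounds j)) (≤-reflexive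
        (sumFin-atMostOnePositive k (partCount-atMostOnePositive proper j) i pos))

    colours-total≤ : sumFin k colours ≤ r
    colours-total≤ = begin
      sumFin k colours
        ≡⟨ sumFin-comm k r (λ i j → signum (partCount i j)) ⟩
      sumFin r (λ j → sumFin k (λ i → signum (partCount i j)))
        ≤⟨ sumFin-mono-≤ r (sumFin-signum-atMostOnePositive k ∘ partCount-atMostOnePositive proper) ⟩
      sumFin r (λ _ → 1)
        ≡⟨ sumFin-one r ⟩
      r
        ∎
      where open ≤-Reasoning

    colours-total≥ : 1 ≤ s → r ≤ sumFin k colours
    colours-total≥ 1≤s = begin
      r
        ≡⟨ sym (sumFin-one r) ⟩
      sumFin r (λ _ → 1)
        ≤⟨ sumFin-mono-≤ r (λ j → ≤-trans (1≤signum j) (signum-sumFin≤ k (λ i → partCount i j))) ⟩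
      sumFin r (λ j → sumFin k (λ i → signum (partCount i j)))
        ≡⟨ sym (sumFin-comm k r (λ i j → signum (partCount i j))) ⟩
      sumFin k colours
        ∎
      where
      open ≤-Reasoning
      1≤signum : ∀ j → 1 ≤ signum (classSize n c j)
      1≤signum j with classSize n c j | ≤-trans 1≤s (proj₁ (bounds j))
      ... | suc _ | _ = s≤s z≤n

    classCounts : ClassCounts n r s t
    classCounts = record
      { classes = colours ; covers = colours-covers ; fits = colours-fits
      ; total≤ = colours-total≤ ; total≥ = colours-total≥ }

equitable⇒ClassCounts : ∀ {k R} {n : Fin k → ℕ} → EquitableColoring n (suc R) →
                        ClassCounts n (suc R) ⌊ order n / suc R ⌋ ⌈ order n / suc R ⌉
equitable⇒ClassCounts {R = R} {n} C = classCounts colour independent bounds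
  where
  open EquitableColoring C
  s = ⌊ order n / suc R ⌋
  t = ⌈ order n / suc R ⌉
  bounds : ∀ j → s ≤ classSize n colour j × classSize n colour j ≤ t
  bounds j with equitable j
  ... | inj₁ ≡s = ≤-reflexive (sym ≡s) , ≤-trans (≤-reflexive ≡s) (⌊/⌋≤⌈/⌉ R (order n))
  ... | inj₂ ≡t = ≤-trans (⌊/⌋≤⌈/⌉ R (order n)) (≤-reflexive (sym ≡t)) , ≤-reflexive ≡t

someVertex : ∀ {k} {n : Fin k → ℕ} → 2 ≤ k → (∀ i → 1 ≤ n i) → Vertex n
someVertex (s≤s _) n>0 = zero , fromℕ< (n>0 zero)

noEquitable0 : ∀ {k} {n : Fin k → ℕ} → Vertex n → ¬ EquitableColoring n 0
noEquitable0 v C with EquitableColoring.colour C v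
... | ()

pVal-zero : ∀ {k} (n : Fin k → ℕ) → pVal n 0 ≡ 0
pVal-zero {k} n = sumFin-zero k (λ _ → refl)

lemma2 : (k : ℕ) → 2 ≤ k → (n : Fin k → ℕ) → (∀ i → 1 ≤ n i) →
         (q : ℕ) → HasEquitableColoring n q →
         (d : ℕ) → IsMinD n q d →
         ¬ HasEquitableColoring n (pVal n d ∸ 1)
-- The junk value ⌈ x / 0 ⌉ = 0 turns the case d = 0 into the absence of 0-colourings.
lemma2 k 2≤k n n>0 _ _ zero _ rewrite pVal-zero n = noEquitable0 (someVertex 2≤k n>0)
lemma2 k 2≤k n n>0 _ _ (suc d) ((_ , cond) , _) with pVal n (suc d) in p≡
... | zero        = noEquitable0 (someVertex 2≤k n>0)
... | suc zero    = noEquitable0 (someVertex 2≤k n>0)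
... | suc (suc R) = λ C → ClassCounts⇒pVal≢1+ 2≤k n>0 cond (equitable⇒ClassCounts C)
                            (⌈/⌉≤1+⌊/⌋ R (order n)) (sym p≡)
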